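{- For every integer $l\geq 3$, $\sigma^{ - }(P(2l+1,2)) \neq 5$.
   Context: For $n \geq 3$, $k \geq 1$ with $2k<n$, the generalized Petersen graph $P(n,k)$ has vertex set $\{u_i, v_i : i=0,1,\dots,n-1\}$ and edge set $\{u_iu_{i+1},\ u_iv_i,\ v_iv_{i+k} : i=0,\dots,n-1\}$, subscripts read modulo $n$. For a simple connected graph $G$ of order $N$, the \textbf{rna} number $\sigma^{ - }(G)$ is the minimum, over all bijections $f: V(G)\to\{1,2,\dots,N\}$, of the number of edges $uv$ of $G$ such that $f(u)$ and $f(v)$ have different parity. -}

module Defs where

open import Data.Nat using (ℕ; suc; _+_; _*_; _%_; _≤_; NonZero)
open import Data.Nat.DivMod using (m%n<n)
open import Data.Fin using (Fin; toℕ; fromℕ<)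
open import Data.Fin.Base using ()
open import Data.List using (List; []; _∷_; concatMap; filter; length)
open import Data.List using () renaming (allFin to allFinL)
open import Data.Sum using (_⊎_; inj₁; inj₂)
open import Data.Product using (_×_; _,_; Σ; ∃)
open import Data.Nat using (_≟_)
open import Relation.Nullary using (¬_)
open import Relation.Binary.PropositionalEquality using (_≡_)
open import Function.Bundles using (_↔_; Inverse)

-- A (finite, simple) graph presented by its vertex type, its order N and
-- the list of its edges (each edge listed exactly once, as an ordered pair).
record Graph : Set₁ where
  field
    V     : Set
    order : ℕ
    edges : List (V × V)

open Graph public

_+ₘ_ : ∀ {n} {{_ : NonZero n}} → Fin n → ℕ → Fin n
_+ₘ_ {n} i j = fromℕ< (m%n<n (toℕ i + j) n)

-- Generalized Petersen graph P(n,k): u_i = inj₁ i, v_i = inj₂ i.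
-- For n ≥ 3 and 2k < n these 3n edges are pairwise distinct, so the list
-- has no repetitions.
GP : (n : ℕ) {{_ : NonZero n}} → ℕ → Graph
GP n k = record
  { V     = Fin n ⊎ Fin n
  ; order = n + n
  ; edges = concatMap (λ i → (inj₁ i , inj₁ (i +ₘ 1))
                           ∷ (inj₁ i , inj₂ i)
                           ∷ (inj₂ i , inj₂ (i +ₘ k)) ∷ [])
                      (allFinL n)
  }

-- A labelling is a bijection f : V(G) → {1,…,N}; we represent the label
-- set {1,…,N} by Fin N with label value 1 + toℕ.
Labelling : Graph → Set
Labelling G = V G ↔ Fin (order G)

label : (G : Graph) → Labelling G → V G → ℕ
label G f x = suc (toℕ (Inverse.to f x))

oddEdges : (G : Graph) → Labelling G → ℕ
oddEdges G f =
  length (filter (λ e → ¬? (label G f (proj₁′ e) % 2 ≟ label G f (proj₂′ e) % 2)) (edges G))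
  where
    open import Relation.Nullary.Decidable using (¬?)
    open import Data.Product using () renaming (proj₁ to proj₁′; proj₂ to proj₂′)

RnaNumber : Graph → ℕ → Set
RnaNumber G m = (Σ (Labelling G) λ f → oddEdges G f ≡ m)
              × ((g : Labelling G) → m ≤ oddEdges G g)

-- Record the parities of a labelling of P(n,2), n = 2l+1, as two 2-colourings X (outer
-- cycle) and Y (inner vertices) of ℤ_n.  The odd edges split into A outer cuts, C spokes
-- and B cuts of the inner cycle i ~ i+2, a single n-cycle since n is odd.  A and B are
-- even, and exactly n labels are odd, so A + B + C = 5 forces A = 0, B = 0 or
-- (A, B, C) = (2, 2, 1).  If X or Y is constant every spoke is odd and C = n ≥ 7.
-- Otherwise Y is X flipped at one vertex p, X consists of two arcs, and the colour of p
-- occurs l + 1 ≥ 4 times in X.  If an arc is a single vertex the colour counts are 1 and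
-- 2l.  If not, X has 4 inner cuts, and the flip lowers them to 2 only when p ± 2 both
-- carry the other colour, which confines the arc of p to at most three vertices.
module Submission where

open import Data.Bool using (Bool; true; false; not; _∧_; _xor_; if_then_else_)
open import Data.Empty using (⊥; ⊥-elim)
open import Data.Fin using (Fin; toℕ; fromℕ<; splitAt)
import Data.Fin as Fin
open import Data.Fin.Properties using (fromℕ<-cong; fromℕ<-toℕ; toℕ<n; +↔⊎)
open import Data.List using (List; []; _∷_; _++_; length; filter; concatMap; tabulate)
open import Data.List.Properties using (filter-++; length-++)
open import Data.Nat
open import Data.Nat.DivMod using (m%n<n; [m+n]%n≡m%n; [m+kn]%n≡m%n; m<n⇒m%n≡m; m*n%n≡0; m≡m%n+[m/n]*n)
open import Data.Nat.Properties
open import Data.Nat.Solver using (module +-*-Solver)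
open import Data.Product using (∃-syntax; _×_; _,_; proj₁; proj₂)
open import Data.Sum using (_⊎_; inj₁; inj₂)
import Data.Sum as Sum
open import Function.Base using (_∘_; id)
open import Function.Properties.Inverse using (↔-trans)
open import Relation.Binary.PropositionalEquality
open import Relation.Nullary using (¬_; does; yes; no)
open import Relation.Nullary.Decidable using (¬?)
open import Relation.Unary using (Pred; Decidable)
open import Algebra.Properties.CommutativeMonoid.Sum +-0-commutativeMonoid using (sum; sum-cong-≗; sum-permute)
open import Algebra.Properties.CommutativeSemigroup +-commutativeSemigroup using (interchange; xy∙z≈xz∙y)

open import Defs

open +-*-Solver using (solve; _:+_; _:*_; _:=_; con)
open ≡-Reasoning

-- Defined through the library's sum so that sum-permute applies; it still unfolds as
-- ∑ (suc n) f = f 0 + ∑ n (f ∘ suc).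
∑ : ℕ → (ℕ → ℕ) → ℕ
∑ n f = sum {n} (f ∘ toℕ)

∑-cong : ∀ n {f g : ℕ → ℕ} → (∀ i → i < n → f i ≡ g i) → ∑ n f ≡ ∑ n g
∑-cong zero    _   = refl
∑-cong (suc n) f≗g = cong₂ _+_ (f≗g 0 z<s) (∑-cong n (λ i i<n → f≗g (suc i) (s<s i<n)))

∑-distrib-+ : ∀ n (f g : ℕ → ℕ) → ∑ n (λ i → f i + g i) ≡ ∑ n f + ∑ n g
∑-distrib-+ zero    f g = refl
∑-distrib-+ (suc n) f g = begin
  (f 0 + g 0) + ∑ n (λ i → f (suc i) + g (suc i))
    ≡⟨ cong (f 0 + g 0 +_) (∑-distrib-+ n (f ∘ suc) (g ∘ suc)) ⟩
  (f 0 + g 0) + (∑ n (f ∘ suc) + ∑ n (g ∘ suc))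
    ≡⟨ interchange (f 0) (g 0) _ _ ⟩
  (f 0 + ∑ n (f ∘ suc)) + (g 0 + ∑ n (g ∘ suc)) ∎

∑-distribʳ-* : ∀ n c (f : ℕ → ℕ) → ∑ n (λ i → f i * c) ≡ ∑ n f * c
∑-distribʳ-* zero    c f = refl
∑-distribʳ-* (suc n) c f =
  trans (cong (f 0 * c +_) (∑-distribʳ-* n c (f ∘ suc))) (sym (*-distribʳ-+ c (f 0) _))

∑-const : ∀ n c → ∑ n (λ _ → c) ≡ n * c
∑-const zero    c = refl
∑-const (suc n) c = cong (c +_) (∑-const n c)

∑-init-last : ∀ n f → ∑ (suc n) f ≡ ∑ n f + f n
∑-init-last zero    f = +-comm (f 0) 0
∑-init-last (suc n) f =
  trans (cong (f 0 +_) (∑-init-last n (f ∘ suc))) (sym (+-assoc (f 0) _ _))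

∑≡0⇒ : ∀ n f → ∑ n f ≡ 0 → ∀ i → i < n → f i ≡ 0
∑≡0⇒ (suc n) f ∑≡0 zero    _         = m+n≡0⇒m≡0 (f 0) ∑≡0
∑≡0⇒ (suc n) f ∑≡0 (suc i) (s<s i<n) = ∑≡0⇒ n (f ∘ suc) (m+n≡0⇒n≡0 (f 0) ∑≡0) i i<n

∑≢0⇒ : ∀ n f → ∑ n f ≢ 0 → ∃[ i ] i < n × f i ≢ 0
∑≢0⇒ zero    f ∑≢0 = ⊥-elim (∑≢0 refl)
∑≢0⇒ (suc n) f ∑≢0 with f 0 ≟ 0
... | no  f0≢0 = 0 , z<s , f0≢0
... | yes f0≡0 with ∑≢0⇒ n (f ∘ suc) (λ rest≡0 → ∑≢0 (cong₂ _+_ f0≡0 rest≡0))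
...   | i , i<n , fi≢0 = suc i , s<s i<n , fi≢0

m+n≡1⇒n≡0 : ∀ m n → m ≢ 0 → m + n ≡ 1 → n ≡ 0
m+n≡1⇒n≡0 zero          n m≢0 _  = ⊥-elim (m≢0 refl)
m+n≡1⇒n≡0 (suc zero)    n _   eq = suc-injective eq
m+n≡1⇒n≡0 (suc (suc m)) n _   ()

∑≡1⇒ : ∀ n f {p} → ∑ n f ≡ 1 → p < n → f p ≢ 0 → ∀ i → i < n → i ≢ p → f i ≡ 0
∑≡1⇒ (suc n) f {zero}  _   _ _    zero    _         i≢p = ⊥-elim (i≢p refl)
∑≡1⇒ (suc n) f {zero}  ∑≡1 _ f0≢0 (suc i) (s<s i<n) _   =
  ∑≡0⇒ n (f ∘ suc) (m+n≡1⇒n≡0 (f 0) _ f0≢0 ∑≡1) i i<n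
∑≡1⇒ (suc n) f {suc p} ∑≡1 (s<s p<n) fp≢0 = λ where
    zero    _         _   → f0≡0
    (suc i) (s<s i<n) i≢p → ∑≡1⇒ n (f ∘ suc) rest≡1 p<n fp≢0 i i<n (i≢p ∘ cong suc)
  where
  rest≢0 : ∑ n (f ∘ suc) ≢ 0
  rest≢0 rest≡0 = fp≢0 (∑≡0⇒ n (f ∘ suc) rest≡0 p p<n)
  f0≡0 : f 0 ≡ 0
  f0≡0 = m+n≡1⇒n≡0 _ (f 0) rest≢0 (trans (+-comm _ (f 0)) ∑≡1)
  rest≡1 : ∑ n (f ∘ suc) ≡ 1
  rest≡1 = trans (cong (_+ ∑ n (f ∘ suc)) (sym f0≡0)) ∑≡1

∑-rotate : ∀ n (f : ℕ → ℕ) → (∀ m → f (m + n) ≡ f m) →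
           ∀ t → ∑ n (λ i → f (i + t)) ≡ ∑ n f
∑-rotate n f f-periodic zero    = ∑-cong n (λ i _ → cong f (+-identityʳ i))
∑-rotate n f f-periodic (suc t) = begin
  ∑ n (λ i → f (i + suc t))   ≡⟨ ∑-cong n (λ i _ → cong f (+-suc i t)) ⟩
  ∑ n (λ i → f (suc i + t))   ≡⟨ +-cancelʳ-≡ (f t) _ _ shift ⟩
  ∑ n (λ i → f (i + t))       ≡⟨ ∑-rotate n f f-periodic t ⟩
  ∑ n f                       ∎
  where
  shift : ∑ n (λ i → f (suc i + t)) + f t ≡ ∑ n (λ i → f (i + t)) + f t
  shift = begin
    ∑ n (λ i → f (suc i + t)) + f t ≡⟨ +-comm _ (f t) ⟩
    ∑ (suc n) (λ i → f (i + t))     ≡⟨ ∑-init-last n (λ i → f (i + t)) ⟩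
    ∑ n (λ i → f (i + t)) + f (n + t)
      ≡⟨ cong (λ j → ∑ n (λ i → f (i + t)) + f j) (+-comm n t) ⟩
    ∑ n (λ i → f (i + t)) + f (t + n)
      ≡⟨ cong (∑ n (λ i → f (i + t)) +_) (f-periodic t) ⟩
    ∑ n (λ i → f (i + t)) + f t     ∎

bit : Bool → ℕ
bit false = 0
bit true  = 1

differ : Bool → Bool → ℕ
differ a b = bit (a xor b)

bit≤1 : ∀ b → bit b ≤ 1
bit≤1 false = z≤n
bit≤1 true  = ≤-refl

bit+bit-not : ∀ b → bit b + bit (not b) ≡ 1
bit+bit-not false = refl
bit+bit-not true  = refl

differ≡0⇒≡ : ∀ a b → differ a b ≡ 0 → a ≡ b
differ≡0⇒≡ false false _ = refl
differ≡0⇒≡ true  true  _ = refl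

differ≢0⇒≡not : ∀ a b → differ a b ≢ 0 → b ≡ not a
differ≢0⇒≡not false true  _  = refl
differ≢0⇒≡not true  false _  = refl
differ≢0⇒≡not false false ne = ⊥-elim (ne refl)
differ≢0⇒≡not true  true  ne = ⊥-elim (ne refl)

differ-comm : ∀ a b → differ a b ≡ differ b a
differ-comm false false = refl
differ-comm false true  = refl
differ-comm true  false = refl
differ-comm true  true  = refl

differ+both : ∀ a b → differ a b + bit (a ∧ b) * 2 ≡ bit a + bit b
differ+both false false = refl
differ+both false true  = refl
differ+both true  false = refl
differ+both true  true  = refl

differ-path : ∀ a b c → differ a c + differ a b * differ b c * 2 ≡ differ a b + differ b c
differ-path false false false = refl
differ-path false false true  = refl
differ-path false true  false = refl
differ-path false true  true  = refl
differ-path true  false false = refl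
differ-path true  false true  = refl
differ-path true  true  false = refl
differ-path true  true  true  = refl

Periodic : ℕ → (ℕ → Bool) → Set
Periodic n X = ∀ m → X (m + n) ≡ X m

rotate : ℕ → (ℕ → Bool) → ℕ → Bool
rotate r X i = X (i + r)

ones : ℕ → (ℕ → Bool) → ℕ
ones n X = ∑ n (λ i → bit (X i))

mismatches : ℕ → (ℕ → Bool) → (ℕ → Bool) → ℕ → ℕ
mismatches n X Y k = ∑ n (λ i → differ (X i) (Y (i + k)))

cuts : ℕ → (ℕ → Bool) → ℕ → ℕ
cuts n X k = mismatches n X X k

spikes : ℕ → (ℕ → Bool) → ℕ
spikes n X = ∑ n (λ i → differ (X i) (X (1 + i)) * differ (X (1 + i)) (X (2 + i)))

Periodic-rotate : ∀ {n X} r → Periodic n X → Periodic n (rotate r X)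
Periodic-rotate {n} {X} r X-periodic m = trans (cong X (xy∙z≈xz∙y m n r)) (X-periodic (m + r))

mismatches-rotate : ∀ {n X Y} → Periodic n X → Periodic n Y →
                    ∀ k r → mismatches n (rotate r X) (rotate r Y) k ≡ mismatches n X Y k
mismatches-rotate {n} {X} {Y} X-periodic Y-periodic k r = begin
  ∑ n (λ i → differ (X (i + r)) (Y (i + k + r)))
    ≡⟨ ∑-cong n (λ i _ → cong (differ (X (i + r)) ∘ Y) (xy∙z≈xz∙y i k r)) ⟩
  ∑ n (λ i → differ (X (i + r)) (Y (i + r + k)))
    ≡⟨ ∑-rotate n (λ i → differ (X i) (Y (i + k))) periodic r ⟩
  mismatches n X Y k ∎
  where
  periodic : ∀ m → differ (X (m + n)) (Y (m + n + k)) ≡ differ (X m) (Y (m + k))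
  periodic m = cong₂ differ (X-periodic m) (trans (cong Y (xy∙z≈xz∙y m n k)) (Y-periodic (m + k)))

mismatches+both : ∀ {n} X {Y} → Periodic n Y → ∀ k →
  mismatches n X Y k + ∑ n (λ i → bit (X i ∧ Y (i + k))) * 2 ≡ ones n X + ones n Y
mismatches+both {n} X {Y} Y-periodic k = begin
  mismatches n X Y k + ∑ n (λ i → bit (X i ∧ Y (i + k))) * 2
    ≡⟨ cong (mismatches n X Y k +_) (∑-distribʳ-* n 2 both) ⟨
  mismatches n X Y k + ∑ n (λ i → both i * 2)
    ≡⟨ ∑-distrib-+ n (λ i → differ (X i) (Y (i + k))) (λ i → both i * 2) ⟨
  ∑ n (λ i → differ (X i) (Y (i + k)) + bit (X i ∧ Y (i + k)) * 2)
    ≡⟨ ∑-cong n (λ i _ → differ+both (X i) (Y (i + k))) ⟩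
  ∑ n (λ i → bit (X i) + bit (Y (i + k)))
    ≡⟨ ∑-distrib-+ n (bit ∘ X) (λ i → bit (Y (i + k))) ⟩
  ones n X + ∑ n (λ i → bit (Y (i + k)))
    ≡⟨ cong (ones n X +_) (∑-rotate n (bit ∘ Y) (cong bit ∘ Y-periodic) k) ⟩
  ones n X + ones n Y ∎
  where
  both : ℕ → ℕ
  both i = bit (X i ∧ Y (i + k))

ones-rotate : ∀ {n X} r → Periodic n X → ones n (rotate r X) ≡ ones n X
ones-rotate {n} {X} r X-periodic = ∑-rotate n (bit ∘ X) (cong bit ∘ X-periodic) r

cuts-even : ∀ {n X} → Periodic n X → ∀ k → cuts n X k % 2 ≡ 0
cuts-even {n} {X} X-periodic k = begin
  cuts n X k % 2              ≡⟨ [m+kn]%n≡m%n (cuts n X k) both 2 ⟨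
  (cuts n X k + both * 2) % 2 ≡⟨ cong (_% 2) (mismatches+both X X-periodic k) ⟩
  (ones n X + ones n X) % 2   ≡⟨ cong (λ m → (ones n X + m) % 2) (+-identityʳ (ones n X)) ⟨
  (2 * ones n X) % 2          ≡⟨ cong (_% 2) (*-comm 2 (ones n X)) ⟩
  (ones n X * 2) % 2          ≡⟨ m*n%n≡0 (ones n X) 2 ⟩
  0                           ∎
  where
  both : ℕ
  both = ∑ n (λ i → bit (X i ∧ X (i + k)))

-- Each spike is a pair of consecutive changes that step 2 jumps over.
cuts₂+spikes : ∀ {n X} → Periodic n X → cuts n X 2 + spikes n X * 2 ≡ cuts n X 1 * 2
cuts₂+spikes {n} {X} X-periodic = begin
  cuts n X 2 + spikes n X * 2
    ≡⟨ cong (cuts n X 2 +_) (∑-distribʳ-* n 2 (λ i → e i * e (1 + i))) ⟨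
  cuts n X 2 + ∑ n (λ i → e i * e (1 + i) * 2)
    ≡⟨ ∑-distrib-+ n (λ i → differ (X i) (X (i + 2))) (λ i → e i * e (1 + i) * 2) ⟨
  ∑ n (λ i → differ (X i) (X (i + 2)) + e i * e (1 + i) * 2)
    ≡⟨ ∑-cong n (λ i _ → pointwise i) ⟩
  ∑ n (λ i → d i + d (i + 1))
    ≡⟨ ∑-distrib-+ n d (λ i → d (i + 1)) ⟩
  cuts n X 1 + ∑ n (λ i → d (i + 1))
    ≡⟨ cong (cuts n X 1 +_) (∑-rotate n d d-periodic 1) ⟩
  cuts n X 1 + cuts n X 1
    ≡⟨ cong (cuts n X 1 +_) (+-identityʳ (cuts n X 1)) ⟨
  2 * cuts n X 1
    ≡⟨ *-comm 2 (cuts n X 1) ⟩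
  cuts n X 1 * 2 ∎
  where
  d : ℕ → ℕ
  d i = differ (X i) (X (i + 1))
  e : ℕ → ℕ
  e i = differ (X i) (X (1 + i))
  d-periodic : ∀ m → d (m + n) ≡ d m
  d-periodic m = cong₂ differ (X-periodic m) (trans (cong X (xy∙z≈xz∙y m n 1)) (X-periodic (m + 1)))
  pointwise : ∀ i → differ (X i) (X (i + 2)) + e i * e (1 + i) * 2 ≡ d i + d (i + 1)
  pointwise i rewrite +-comm i 1 | +-comm i 1 | +-comm i 2 = differ-path (X i) (X (1 + i)) (X (2 + i))

run-constant : ∀ (X : ℕ → Bool) K M → ∑ M (λ i → differ (X (K + i)) (X (K + i + 1))) ≡ 0 →
               ∀ s → s ≤ M → X (K + s) ≡ X K
run-constant X K M no-change zero    _       = cong X (+-identityʳ K)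
run-constant X K M no-change (suc s) 1+s≤M = begin
  X (K + suc s)   ≡⟨ cong X (trans (+-assoc K s 1) (cong (K +_) (+-comm s 1))) ⟨
  X (K + s + 1)   ≡⟨ differ≡0⇒≡ _ _ (∑≡0⇒ M _ no-change s 1+s≤M) ⟨
  X (K + s)       ≡⟨ run-constant X K M no-change s (<⇒≤ 1+s≤M) ⟩
  X K             ∎

∑-bit-run : ∀ (X : ℕ → Bool) K M → ∑ M (λ i → differ (X (K + i)) (X (K + i + 1))) ≡ 0 →
            ∑ M (λ i → bit (X (K + i))) ≡ M * bit (X K)
∑-bit-run X K M no-change = begin
  ∑ M (λ i → bit (X (K + i)))
    ≡⟨ ∑-cong M (λ i i<M → cong bit (run-constant X K M no-change i (<⇒≤ i<M))) ⟩
  ∑ M (λ _ → bit (X K))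
    ≡⟨ ∑-const M (bit (X K)) ⟩
  M * bit (X K) ∎

periodic-+* : ∀ {n X} → Periodic n X → ∀ m q → X (m + q * n) ≡ X m
periodic-+* {n} {X} X-periodic m zero    = cong X (+-identityʳ m)
periodic-+* {n} {X} X-periodic m (suc q) = begin
  X (m + (n + q * n)) ≡⟨ cong X (trans (+-assoc m (q * n) n) (cong (m +_) (+-comm (q * n) n))) ⟨
  X (m + q * n + n)   ≡⟨ X-periodic (m + q * n) ⟩
  X (m + q * n)       ≡⟨ periodic-+* X-periodic m q ⟩
  X m                 ∎

periodic-mod : ∀ {n X} .{{_ : NonZero n}} → Periodic n X → ∀ m → X m ≡ X (m % n)
periodic-mod {n} {X} X-periodic m =
  trans (cong X (m≡m%n+[m/n]*n m n)) (periodic-+* X-periodic (m % n) (m / n))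

periodic-≗ : ∀ {n X Z} .{{_ : NonZero n}} → Periodic n X → Periodic n Z →
             (∀ i → i < n → X i ≡ Z i) → ∀ m → X m ≡ Z m
periodic-≗ {n} {X} {Z} X-periodic Z-periodic agree m = begin
  X m       ≡⟨ periodic-mod X-periodic m ⟩
  X (m % n) ≡⟨ agree (m % n) (m%n<n m n) ⟩
  Z (m % n) ≡⟨ periodic-mod Z-periodic m ⟨
  Z m       ∎

-- On an odd cycle, steps of 2 reach every position: m + 1 + 2l is m + n.
inner-cut-free⇒constant : ∀ l {Y} → Periodic (suc (2 * l)) Y → cuts (suc (2 * l)) Y 2 ≡ 0 →
                          ∀ i → Y i ≡ Y 0
inner-cut-free⇒constant l {Y} Y-periodic no-change = constant
  where
  n = suc (2 * l)
  step-2 : ∀ m → Y m ≡ Y (m + 2)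
  step-2 = periodic-≗ Y-periodic (Periodic-rotate 2 Y-periodic)
             (λ i i<n → differ≡0⇒≡ _ _ (∑≡0⇒ n (λ i → differ (Y i) (Y (i + 2))) no-change i i<n))
  steps-2 : ∀ m s → Y (m + s * 2) ≡ Y m
  steps-2 m zero    = cong Y (+-identityʳ m)
  steps-2 m (suc s) = begin
    Y (m + (2 + s * 2)) ≡⟨ cong Y (trans (+-assoc m (s * 2) 2) (cong (m +_) (+-comm (s * 2) 2))) ⟨
    Y (m + s * 2 + 2)   ≡⟨ step-2 (m + s * 2) ⟨
    Y (m + s * 2)       ≡⟨ steps-2 m s ⟩
    Y m                 ∎
  step-1 : ∀ m → Y (suc m) ≡ Y m
  step-1 m = begin
    Y (suc m)             ≡⟨ steps-2 (suc m) l ⟨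
    Y (suc m + l * 2)     ≡⟨ cong Y (trans (cong (suc m +_) (*-comm l 2)) (sym (+-suc m (2 * l)))) ⟩
    Y (m + n)             ≡⟨ Y-periodic m ⟩
    Y m                   ∎
  constant : ∀ i → Y i ≡ Y 0
  constant zero    = refl
  constant (suc i) = trans (step-1 i) (constant i)

mismatches-constantˡ : ∀ {n X Y x} → Periodic n Y → (∀ i → i < n → X i ≡ x) →
                       ones n X + ones n Y ≡ n → mismatches n X Y 0 ≡ n
mismatches-constantˡ {n} {X} {Y} {x} Y-periodic X≡x ones≡n = begin
  mismatches n X Y 0                ≡⟨ +-identityʳ _ ⟨
  mismatches n X Y 0 + 0 * 2        ≡⟨ cong (λ c → mismatches n X Y 0 + c * 2) (both≡0 x X≡x) ⟨
  mismatches n X Y 0 + both * 2     ≡⟨ mismatches+both X Y-periodic 0 ⟩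
  ones n X + ones n Y               ≡⟨ ones≡n ⟩
  n                                 ∎
  where
  both : ℕ
  both = ∑ n (λ i → bit (X i ∧ Y (i + 0)))
  both≡0 : ∀ b → (∀ i → i < n → X i ≡ b) → both ≡ 0
  both≡0 false X≡false = begin
    both                  ≡⟨ ∑-cong n (λ i i<n → cong (λ b → bit (b ∧ Y (i + 0))) (X≡false i i<n)) ⟩
    ∑ n (λ _ → 0)         ≡⟨ ∑-const n 0 ⟩
    n * 0                 ≡⟨ *-zeroʳ n ⟩
    0                     ∎
  both≡0 true  X≡true  = begin
    both                  ≡⟨ ∑-cong n (λ i i<n → cong (λ b → bit (b ∧ Y (i + 0))) (X≡true i i<n)) ⟩
    ∑ n (λ i → bit (Y (i + 0))) ≡⟨ ∑-cong n (λ i _ → cong (bit ∘ Y) (+-identityʳ i)) ⟩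
    ones n Y              ≡⟨ +-cancelˡ-≡ n (ones n Y) 0 n+onesY≡n+0 ⟩
    0                     ∎
    where
    onesX≡n : ones n X ≡ n
    onesX≡n = begin
      ones n X        ≡⟨ ∑-cong n (λ i i<n → cong bit (X≡true i i<n)) ⟩
      ∑ n (λ _ → 1)   ≡⟨ ∑-const n 1 ⟩
      n * 1           ≡⟨ *-identityʳ n ⟩
      n               ∎
    n+onesY≡n+0 : n + ones n Y ≡ n + 0
    n+onesY≡n+0 = trans (cong (_+ ones n Y) (sym onesX≡n)) (trans ones≡n (sym (+-identityʳ n)))

spike-shape : ∀ x₀ x₁ x₂ t → differ x₀ x₁ * differ x₁ x₂ ≢ 0 →
              differ x₀ x₁ + (differ x₁ x₂ + t) ≡ 2 → t ≡ 0 × x₁ ≡ not x₀ × x₂ ≡ x₀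
spike-shape false true  false _ _     refl = refl , refl , refl
spike-shape true  false true  _ _     refl = refl , refl , refl
spike-shape false false _     _ spike _    = ⊥-elim (spike refl)
spike-shape true  true  _     _ spike _    = ⊥-elim (spike refl)
spike-shape false true  true  _ spike _    = ⊥-elim (spike refl)
spike-shape true  false false _ spike _    = ⊥-elim (spike refl)

ones-single-spike : ∀ b M → bit b + (bit (not b) + M * bit b) ≡ 1
                          ⊎ bit b + (bit (not b) + M * bit b) ≡ 1 + M
ones-single-spike false M = inj₁ (cong suc (*-zeroʳ M))
ones-single-spike true  M = inj₂ (cong suc (*-identityʳ M))

-- A spike uses up both changes, so its vertex is the only one of its colour.
two-cuts-spike⇒ones : ∀ M {X} → Periodic (2 + M) X → cuts (2 + M) X 1 ≡ 2 → spikes (2 + M) X ≢ 0 →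
                      ones (2 + M) X ≡ 1 ⊎ ones (2 + M) X ≡ 1 + M
two-cuts-spike⇒ones M {X} X-periodic cuts≡2 spikes≢0 = spike-at (∑≢0⇒ (2 + M) _ spikes≢0)
  where
  spike-at : ∃[ k ] k < 2 + M × differ (X k) (X (1 + k)) * differ (X (1 + k)) (X (2 + k)) ≢ 0 →
             ones (2 + M) X ≡ 1 ⊎ ones (2 + M) X ≡ 1 + M
  spike-at (k , _ , spike) = Sum.map (trans ones≡) (trans ones≡) (ones-single-spike (Z 0) M)
    where
    Z = rotate k X
    shape = spike-shape (Z 0) (Z 1) (Z 2) _ spike (trans (mismatches-rotate X-periodic X-periodic 1 k) cuts≡2)
    ones≡ : ones (2 + M) X ≡ bit (Z 0) + (bit (not (Z 0)) + M * bit (Z 0))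
    ones≡ = begin
      ones (2 + M) X
        ≡⟨ ones-rotate k X-periodic ⟨
      bit (Z 0) + (bit (Z 1) + ∑ M (λ i → bit (Z (2 + i))))
        ≡⟨ cong (λ b → bit (Z 0) + (bit b + ∑ M (λ i → bit (Z (2 + i))))) (proj₁ (proj₂ shape)) ⟩
      bit (Z 0) + (bit (not (Z 0)) + ∑ M (λ i → bit (Z (2 + i))))
        ≡⟨ cong (λ s → bit (Z 0) + (bit (not (Z 0)) + s)) (∑-bit-run Z 2 M (proj₁ shape)) ⟩
      bit (Z 0) + (bit (not (Z 0)) + M * bit (Z 2))
        ≡⟨ cong (λ b → bit (Z 0) + (bit (not (Z 0)) + M * bit b)) (proj₂ (proj₂ shape)) ⟩
      bit (Z 0) + (bit (not (Z 0)) + M * bit (Z 0)) ∎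

even-split-5 : ∀ A B C → A % 2 ≡ 0 → B % 2 ≡ 0 → A + (B + C) ≡ 5 →
               A ≡ 0 ⊎ B ≡ 0 ⊎ (A ≡ 2 × B ≡ 2 × C ≡ 1)
even-split-5 0 _ _ _ _ _ = inj₁ refl
even-split-5 (suc _) 0 _ _ _ _ = inj₂ (inj₁ refl)
even-split-5 1 (suc _) _ () _ _
even-split-5 2 1 _ _ () _
even-split-5 2 2 1 _ _ refl = inj₂ (inj₂ (refl , refl , refl))
even-split-5 2 3 _ _ () _
even-split-5 2 (suc (suc (suc (suc _)))) _ _ _ ()
even-split-5 3 (suc _) _ () _ _
even-split-5 4 1 _ _ () _
even-split-5 4 (suc (suc _)) _ _ _ ()
even-split-5 5 (suc _) _ _ _ ()
even-split-5 (suc (suc (suc (suc (suc (suc _)))))) (suc _) _ _ _ ()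

inner-flip : ∀ x₀ x₂ x₄ w → differ x₀ x₂ + differ x₂ x₄ + w ≡ 4 →
             differ x₀ (not x₂) + differ (not x₂) x₄ + w ≡ 2 → x₀ ≡ not x₂ × x₄ ≡ not x₂
inner-flip true  false true  _ refl refl = refl , refl
inner-flip false true  false _ refl refl = refl , refl
inner-flip true  true  true  _ refl ()
inner-flip true  true  false _ refl ()
inner-flip true  false false _ refl ()
inner-flip false true  true  _ refl ()
inner-flip false false true  _ refl ()
inner-flip false false false _ refl ()

two-changes : ∀ x₁ x₂ x₃ t →
  differ (not x₂) x₁ + (differ x₁ x₂ + (differ x₂ x₃ + (differ x₃ (not x₂) + t))) ≡ 2 → t ≡ 0
two-changes false false false _ refl = refl
two-changes false false true  _ refl = refl
two-changes false true  false _ refl = refl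
two-changes false true  true  _ refl = refl
two-changes true  false false _ refl = refl
two-changes true  false true  _ refl = refl
two-changes true  true  false _ refl = refl
two-changes true  true  true  _ refl = refl

spiky-count-impossible : ∀ {l M} b → 3 ≤ l → 4 + M ≡ suc (2 * l) →
                         ¬ (l + bit b ≡ 1 ⊎ l + bit b ≡ 3 + M)
spiky-count-impossible {l} b 3≤l _ (inj₁ l+b≡1) =
  ≤⇒≯ (≤-trans (m≤m+n l (bit b)) (≤-reflexive l+b≡1)) (≤-trans (s≤s (s≤s z≤n)) 3≤l)
spiky-count-impossible {l} b 3≤l n≡ (inj₂ l+b≡3+M) =
  ≤⇒≯ (≤-trans (m≤m+n l 0) (≤-trans (≤-reflexive l+0≡b) (bit≤1 b)))
      (≤-trans (s≤s (s≤s z≤n)) 3≤l)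
  where
  l+0≡b : l + 0 ≡ bit b
  l+0≡b = +-cancelˡ-≡ l (l + 0) (bit b) (trans (sym (suc-injective n≡)) (sym l+b≡3+M))

window-count-impossible : ∀ {l M} x₁ x₂ x₃ → 3 ≤ l → 4 + M ≡ suc (2 * l) →
  bit (not x₂) + (bit x₁ + (bit x₂ + (bit x₃ + M * bit (not x₂)))) ≢ l + bit x₂
window-count-impossible {l} {M} x₁ true x₃ 3≤l _ count≡ = ≤⇒≯ l≤2 3≤l
  where
  l≡ : bit x₁ + (bit x₃ + M * 0) ≡ l
  l≡ = suc-injective (trans (sym (+-suc (bit x₁) _)) (trans count≡ (+-comm l 1)))
  x₃+M*0≡x₃ : bit x₃ + M * 0 ≡ bit x₃
  x₃+M*0≡x₃ = trans (cong (bit x₃ +_) (*-zeroʳ M)) (+-identityʳ _)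
  l≤2 : l ≤ 2
  l≤2 = ≤-trans (≤-reflexive (sym l≡)) (+-mono-≤ (bit≤1 x₁) (≤-trans (≤-reflexive x₃+M*0≡x₃) (bit≤1 x₃)))
window-count-impossible {l} {M} x₁ false x₃ 3≤l n≡ count≡ = <⇒≱ l<3 3≤l
  where
  M<l : M < l
  M<l = ≤-trans (s≤s M≤count) (≤-reflexive (trans count≡ (+-identityʳ l)))
    where
    M≤count : M ≤ bit x₁ + (bit x₃ + M * 1)
    M≤count = ≤-trans (≤-reflexive (sym (*-identityʳ M)))
                      (≤-trans (m≤n+m (M * 1) (bit x₃)) (m≤n+m _ (bit x₁)))
  l+l≡3+M : l + l ≡ 3 + M
  l+l≡3+M = trans (cong (l +_) (sym (+-identityʳ l))) (sym (suc-injective n≡))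
  l<3 : l < 3
  l<3 = +-cancelʳ-< l l 3 (subst (_< 3 + l) (sym l+l≡3+M) (+-monoʳ-< 3 M<l))

move-3rd-last : ∀ a b c d e → a + (b + (c + (d + e))) ≡ (a + (b + (d + e))) + c
move-3rd-last = solve 5 (λ a b c d e → a :+ (b :+ (c :+ (d :+ e))) := (a :+ (b :+ (d :+ e))) :+ c) refl

pair-1st-3rd : ∀ a u b v → a + (u + (b + v)) ≡ a + b + (u + v)
pair-1st-3rd = solve 4 (λ a u b v → a :+ (u :+ (b :+ v)) := a :+ b :+ (u :+ v)) refl

-- The odd spoke sits at position 2, so that its inner neighbours 0 and 4 need no wrap-around.
module SingleSpoke
  {l M : ℕ} (3≤l : 3 ≤ l) (n≡ : 4 + M ≡ suc (2 * l))
  {X Y : ℕ → Bool} (X-periodic : Periodic (4 + M) X) (Y-periodic : Periodic (4 + M) Y)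
  (ones≡n : ones (4 + M) X + ones (4 + M) Y ≡ 4 + M)
  (outer≡2 : cuts (4 + M) X 1 ≡ 2) (inner≡2 : cuts (4 + M) Y 2 ≡ 2)
  (spokes≡1 : mismatches (4 + M) X Y 0 ≡ 1) (spoke₂ : differ (X 2) (Y 2) ≢ 0)
  where

  Y₂≡notX₂ : Y 2 ≡ not (X 2)
  Y₂≡notX₂ = differ≢0⇒≡not (X 2) (Y 2) spoke₂

  agree< : ∀ i → i < 4 + M → i ≢ 2 → X i ≡ Y i
  agree< i i<n i≢2 = trans (differ≡0⇒≡ (X i) (Y (i + 0)) spoke-i≡0) (cong Y (+-identityʳ i))
    where
    spoke-i≡0 = ∑≡1⇒ (4 + M) (λ i → differ (X i) (Y (i + 0))) spokes≡1 (s<s (s<s z<s)) spoke₂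
                     i i<n i≢2

  agree : ∀ i → i < 6 + M → i ≢ 2 → X i ≡ Y i
  agree i i<6+M i≢2 with m<1+n⇒m<n∨m≡n i<6+M
  ... | inj₂ refl = trans (X-periodic 1) (trans (agree< 1 (s<s z<s) (λ ())) (sym (Y-periodic 1)))
  ... | inj₁ i<5+M with m<1+n⇒m<n∨m≡n i<5+M
  ...   | inj₂ refl  = trans (X-periodic 0) (trans (agree< 0 z<s (λ ())) (sym (Y-periodic 0)))
  ...   | inj₁ i<4+M = agree< i i<4+M i≢2

  4+i<6+M : ∀ {i} → i < M → 4 + i < 6 + M
  4+i<6+M i<M = s<s (s<s (s<s (s<s (<-≤-trans i<M (m≤n+m M 2)))))

  ones-without-2 : ℕ
  ones-without-2 = bit (X 0) + (bit (X 1) + (bit (X 3) + ∑ M (λ i → bit (X (4 + i)))))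

  ones-X : ones (4 + M) X ≡ ones-without-2 + bit (X 2)
  ones-X = move-3rd-last (bit (X 0)) (bit (X 1)) (bit (X 2)) (bit (X 3)) _

  ones-Y : ones (4 + M) Y ≡ ones-without-2 + bit (not (X 2))
  ones-Y = begin
    ones (4 + M) Y
      ≡⟨ cong₂ _+_ (at 0 z<s (λ ())) (cong₂ _+_ (at 1 (s<s z<s) (λ ()))
           (cong₂ _+_ (cong bit Y₂≡notX₂) (cong₂ _+_ (at 3 (s<s (s<s (s<s z<s))) (λ ()))
                      (∑-cong M (λ i i<M → at (4 + i) (4+i<6+M i<M) (λ ())))))) ⟩
    bit (X 0) + (bit (X 1) + (bit (not (X 2)) + (bit (X 3) + ∑ M (λ i → bit (X (4 + i))))))
      ≡⟨ move-3rd-last (bit (X 0)) (bit (X 1)) (bit (not (X 2))) (bit (X 3)) _ ⟩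
    ones-without-2 + bit (not (X 2)) ∎
    where
    at : ∀ i → i < 6 + M → i ≢ 2 → bit (Y i) ≡ bit (X i)
    at i i<6+M i≢2 = cong bit (sym (agree i i<6+M i≢2))

  ones-without-2≡l : ones-without-2 ≡ l
  ones-without-2≡l = *-cancelˡ-≡ r l 2 (suc-injective (begin
    suc (2 * r)                          ≡⟨ cong suc (cong (r +_) (+-identityʳ r)) ⟩
    suc (r + r)                          ≡⟨ +-comm 1 (r + r) ⟩
    r + r + 1                            ≡⟨ cong (r + r +_) (bit+bit-not (X 2)) ⟨
    r + r + (bit (X 2) + bit (not (X 2))) ≡⟨ interchange r r _ _ ⟩
    (r + bit (X 2)) + (r + bit (not (X 2))) ≡⟨ cong₂ _+_ ones-X ones-Y ⟨
    ones (4 + M) X + ones (4 + M) Y      ≡⟨ ones≡n ⟩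
    4 + M                                ≡⟨ n≡ ⟩
    suc (2 * l)                          ∎))
    where
    r = ones-without-2

  ones-X≡l+X₂ : ones (4 + M) X ≡ l + bit (X 2)
  ones-X≡l+X₂ = trans ones-X (cong (_+ bit (X 2)) ones-without-2≡l)

  spiky-impossible : spikes (4 + M) X ≢ 0 → ⊥
  spiky-impossible spikes≢0 = spiky-count-impossible (X 2) 3≤l n≡
    (Sum.map (trans (sym ones-X≡l+X₂)) (trans (sym ones-X≡l+X₂))
             (two-cuts-spike⇒ones (2 + M) X-periodic outer≡2 spikes≢0))

  4+i+2<6+M : ∀ {i} → i < M → 4 + i + 2 < 6 + M
  4+i+2<6+M {i} i<M = s<s (s<s (s<s (s<s (subst (_< 2 + M) (+-comm 2 i) (+-monoʳ-< 2 i<M)))))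

  -- Without spikes, step 2 sees each of the two outer changes twice.
  spike-free-impossible : spikes (4 + M) X ≡ 0 → ⊥
  spike-free-impossible spikes≡0 =
    window-count-impossible (X 1) (X 2) (X 3) 3≤l n≡ (trans (sym ones-X≡) ones-X≡l+X₂)
    where
    u = differ (X 1) (X 3)
    v = differ (X 3) (X 5) + ∑ M (λ i → differ (X (4 + i)) (X (4 + i + 2)))
    R = ∑ M (λ i → differ (X (4 + i)) (X (4 + i + 1)))
    inner-X≡4 : cuts (4 + M) X 2 ≡ 4
    inner-X≡4 = begin
      cuts (4 + M) X 2                       ≡⟨ +-identityʳ _ ⟨
      cuts (4 + M) X 2 + 0 * 2               ≡⟨ cong (λ s → cuts (4 + M) X 2 + s * 2) spikes≡0 ⟨
      cuts (4 + M) X 2 + spikes (4 + M) X * 2 ≡⟨ cuts₂+spikes X-periodic ⟩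
      cuts (4 + M) X 1 * 2                   ≡⟨ cong (_* 2) outer≡2 ⟩
      4                                      ∎
    ag : ∀ i → i < 6 + M → i ≢ 2 → Y i ≡ X i
    ag i i<6+M i≢2 = sym (agree i i<6+M i≢2)
    inner-Y : cuts (4 + M) Y 2 ≡ differ (X 0) (not (X 2)) + (u + (differ (not (X 2)) (X 4) + v))
    inner-Y = cong₂ _+_ (cong₂ differ (ag 0 z<s (λ ())) Y₂≡notX₂)
              (cong₂ _+_ (cong₂ differ (ag 1 (s<s z<s) (λ ())) (ag 3 (s<s (s<s (s<s z<s))) (λ ())))
              (cong₂ _+_ (cong₂ differ Y₂≡notX₂ (ag 4 (s<s (s<s (s<s (s<s z<s)))) (λ ())))
              (cong₂ _+_ (cong₂ differ (ag 3 (s<s (s<s (s<s z<s))) (λ ()))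
                                       (ag 5 (s<s (s<s (s<s (s<s (s<s z<s))))) (λ ())))
                         (∑-cong M (λ i i<M → cong₂ differ (ag (4 + i) (4+i<6+M i<M) (λ ()))
                                                            (ag (4 + i + 2) (4+i+2<6+M i<M) (λ ())))))))
    flip = inner-flip (X 0) (X 2) (X 4) (u + v)
             (trans (sym (pair-1st-3rd (differ (X 0) (X 2)) u (differ (X 2) (X 4)) v)) inner-X≡4)
             (trans (sym (pair-1st-3rd (differ (X 0) (not (X 2))) u (differ (not (X 2)) (X 4)) v))
                    (trans (sym inner-Y) inner≡2))
    R≡0 : R ≡ 0
    R≡0 = two-changes (X 1) (X 2) (X 3) R
            (subst₂ (λ a b → differ a (X 1) + (differ (X 1) (X 2) + (differ (X 2) (X 3) + (differ (X 3) b + R)))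
                             ≡ 2)
                    (proj₁ flip) (proj₂ flip) outer≡2)
    ones-X≡ : ones (4 + M) X
              ≡ bit (not (X 2)) + (bit (X 1) + (bit (X 2) + (bit (X 3) + M * bit (not (X 2)))))
    ones-X≡ = cong₂ (λ a b → bit a + (bit (X 1) + (bit (X 2) + (bit (X 3) + b))))
                    (proj₁ flip) (trans (∑-bit-run X 4 M R≡0) (cong (λ b → M * bit b) (proj₂ flip)))

  absurd : ⊥
  absurd with spikes (4 + M) X ≟ 0
  ... | yes spikes≡0 = spike-free-impossible spikes≡0
  ... | no  spikes≢0 = spiky-impossible spikes≢0

mismatches₀-comm : ∀ n X Y → mismatches n X Y 0 ≡ mismatches n Y X 0
mismatches₀-comm n X Y = ∑-cong n (λ i _ → begin
  differ (X i) (Y (i + 0)) ≡⟨ cong (differ (X i) ∘ Y) (+-identityʳ i) ⟩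
  differ (X i) (Y i)       ≡⟨ differ-comm (X i) (Y i) ⟩
  differ (Y i) (X i)       ≡⟨ cong (differ (Y i) ∘ X) (+-identityʳ i) ⟨
  differ (Y i) (X (i + 0)) ∎)

single-spoke-impossible : ∀ l → 3 ≤ l → ∀ {X Y} →
  Periodic (suc (2 * l)) X → Periodic (suc (2 * l)) Y →
  ones (suc (2 * l)) X + ones (suc (2 * l)) Y ≡ suc (2 * l) →
  cuts (suc (2 * l)) X 1 ≡ 2 → cuts (suc (2 * l)) Y 2 ≡ 2 → mismatches (suc (2 * l)) X Y 0 ≡ 1 → ⊥
-- Matching on 3 ≤ l makes n definitionally of the form 4 + M, as SingleSpoke expects.
single-spoke-impossible l 3≤l@(s≤s (s≤s (s≤s _))) {X} {Y} X-periodic Y-periodic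
                        ones≡n outer≡2 inner≡2 spokes≡1 =
  rotate-to-2 (∑≢0⇒ n _ (λ spokes≡0 → 1+n≢0 (trans (sym spokes≡1) spokes≡0)))
  where
  n = suc (2 * l)
  rotate-to-2 : ∃[ j ] j < n × differ (X j) (Y (j + 0)) ≢ 0 → ⊥
  rotate-to-2 (j , _ , spoke) =
    SingleSpoke.absurd 3≤l refl (Periodic-rotate r X-periodic) (Periodic-rotate r Y-periodic)
      (trans (cong₂ _+_ (ones-rotate r X-periodic) (ones-rotate r Y-periodic)) ones≡n)
      (trans (mismatches-rotate X-periodic X-periodic 1 r) outer≡2)
      (trans (mismatches-rotate Y-periodic Y-periodic 2 r) inner≡2)
      (trans (mismatches-rotate X-periodic Y-periodic 0 r) spokes≡1)
      (λ spoke₂≡0 → spoke (trans (cong₂ differ (sym X-at) (sym Y-at)) spoke₂≡0))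
    where
    r = j + (n ∸ 2)
    2+r≡j+n : 2 + r ≡ j + n
    2+r≡j+n = sym (trans (+-suc j _) (cong suc (+-suc j _)))
    X-at : X (2 + r) ≡ X j
    X-at = trans (cong X 2+r≡j+n) (X-periodic j)
    Y-at : Y (2 + r) ≡ Y (j + 0)
    Y-at = trans (cong Y 2+r≡j+n) (trans (Y-periodic j) (cong Y (sym (+-identityʳ j))))

changes≢5 : ∀ l → 3 ≤ l → ∀ {X Y} → Periodic (suc (2 * l)) X → Periodic (suc (2 * l)) Y →
            ones (suc (2 * l)) X + ones (suc (2 * l)) Y ≡ suc (2 * l) →
            cuts (suc (2 * l)) X 1 + (mismatches (suc (2 * l)) X Y 0 + (cuts (suc (2 * l)) Y 2 + 0)) ≢ 5
changes≢5 l 3≤l {X} {Y} X-periodic Y-periodic ones≡n total≡5 =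
  by-cases (even-split-5 A B C (cuts-even X-periodic 1) (cuts-even Y-periodic 2) A+B+C≡5)
  where
  n = suc (2 * l)
  A = cuts n X 1
  B = cuts n Y 2
  C = mismatches n X Y 0
  A+B+C≡5 : A + (B + C) ≡ 5
  A+B+C≡5 = trans (cong (A +_) (trans (+-comm B C) (cong (C +_) (sym (+-identityʳ B))))) total≡5
  C≢n : C ≢ n
  C≢n C≡n = ≤⇒≯ (≤-trans (≤-reflexive (sym C≡n)) C≤5) (<⇒≤ (s≤s (*-monoʳ-≤ 2 3≤l)))
    where
    C≤5 : C ≤ 5
    C≤5 = ≤-trans (m≤n+m C B) (≤-trans (m≤n+m (B + C) A) (≤-reflexive A+B+C≡5))
  by-cases : A ≡ 0 ⊎ B ≡ 0 ⊎ (A ≡ 2 × B ≡ 2 × C ≡ 1) → ⊥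
  by-cases (inj₁ A≡0) =
    C≢n (mismatches-constantˡ Y-periodic (λ i i<n → run-constant X 0 n A≡0 i (<⇒≤ i<n)) ones≡n)
  by-cases (inj₂ (inj₁ B≡0)) =
    C≢n (trans (mismatches₀-comm n X Y)
               (mismatches-constantˡ X-periodic (λ i _ → inner-cut-free⇒constant l Y-periodic B≡0 i)
                                     (trans (+-comm (ones n Y) (ones n X)) ones≡n)))
  by-cases (inj₂ (inj₂ (A≡2 , B≡2 , C≡1))) =
    single-spoke-impossible l 3≤l X-periodic Y-periodic ones≡n A≡2 B≡2 C≡1

module _ {a p} {A : Set a} {P : Pred A p} (P? : Decidable P) where

  length-filter-∷ : ∀ x xs →
    length (filter P? (x ∷ xs)) ≡ (if does (P? x) then 1 else 0) + length (filter P? xs)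
  length-filter-∷ x xs with does (P? x)
  ... | true  = refl
  ... | false = refl

  length-filter-concatMap : ∀ {B : Set} (g : B → List A) m (t : Fin m → B) (H : ℕ → ℕ) →
    (∀ i → length (filter P? (g (t i))) ≡ H (toℕ i)) →
    length (filter P? (concatMap g (tabulate t))) ≡ ∑ m H
  length-filter-concatMap g zero    t H per-block = refl
  length-filter-concatMap g (suc m) t H per-block = begin
    length (filter P? (g (t Fin.zero) ++ concatMap g (tabulate (t ∘ Fin.suc))))
      ≡⟨ cong length (filter-++ P? (g (t Fin.zero)) _) ⟩
    length (filter P? (g (t Fin.zero)) ++ filter P? (concatMap g (tabulate (t ∘ Fin.suc))))
      ≡⟨ length-++ (filter P? (g (t Fin.zero))) ⟩
    length (filter P? (g (t Fin.zero))) + length (filter P? (concatMap g (tabulate (t ∘ Fin.suc))))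
      ≡⟨ cong₂ _+_ (per-block Fin.zero)
                   (length-filter-concatMap g m (t ∘ Fin.suc) (H ∘ suc) (per-block ∘ Fin.suc)) ⟩
    ∑ (suc m) H ∎

sum-splitAt : ∀ m k (g : Fin m ⊎ Fin k → ℕ) →
              sum (g ∘ splitAt m) ≡ sum (g ∘ inj₁) + sum (g ∘ inj₂)
sum-splitAt zero    k g = refl
sum-splitAt (suc m) k g =
  trans (cong (g (inj₁ Fin.zero) +_) (sum-splitAt m k (g ∘ Sum.map Fin.suc id)))
        (sym (+-assoc (g (inj₁ Fin.zero)) _ _))

isOdd : ℕ → Bool
isOdd zero          = false
isOdd (suc zero)    = true
isOdd (suc (suc m)) = isOdd m

%2≡bit-isOdd : ∀ m → m % 2 ≡ bit (isOdd m)
%2≡bit-isOdd zero          = refl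
%2≡bit-isOdd (suc zero)    = refl
%2≡bit-isOdd (suc (suc m)) = trans (trans (cong (_% 2) (+-comm 2 m)) ([m+n]%n≡m%n m 2)) (%2≡bit-isOdd m)

parities-differ : ∀ a b → (if does (¬? (a % 2 ≟ b % 2)) then 1 else 0) ≡ differ (isOdd a) (isOdd b)
parities-differ a b rewrite %2≡bit-isOdd a | %2≡bit-isOdd b with isOdd a | isOdd b
... | false | false = refl
... | false | true  = refl
... | true  | false = refl
... | true  | true  = refl

ones-isOdd-suc : ∀ k → ones (k + k) (isOdd ∘ suc) ≡ k
ones-isOdd-suc zero    = refl
ones-isOdd-suc (suc k) = cong suc (begin
  ones (k + suc k) (isOdd ∘ suc ∘ suc)   ≡⟨ cong (λ N → ones N (isOdd ∘ suc ∘ suc)) (+-suc k k) ⟩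
  ones (suc (k + k)) (isOdd ∘ suc ∘ suc) ≡⟨ ones-isOdd-suc k ⟩
  k                                      ∎)

module _ {n : ℕ} {{_ : NonZero n}} where

  cyclic : ℕ → Fin n
  cyclic m = fromℕ< (m%n<n m n)

  cyclic-periodic : ∀ m → cyclic (m + n) ≡ cyclic m
  cyclic-periodic m = fromℕ<-cong _ _ ([m+n]%n≡m%n m n) _ _

  cyclic-toℕ : ∀ i → cyclic (toℕ i) ≡ i
  cyclic-toℕ i = trans (fromℕ<-cong _ _ (m<n⇒m%n≡m (toℕ<n i)) _ (toℕ<n i)) (fromℕ<-toℕ i (toℕ<n i))

module _ {n k : ℕ} {{_ : NonZero n}} (f : Labelling (GP n k)) where

  private
    lab : Fin n ⊎ Fin n → ℕ
    lab = label (GP n k) f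

  outerParity : ℕ → Bool
  outerParity m = isOdd (lab (inj₁ (cyclic m)))

  innerParity : ℕ → Bool
  innerParity m = isOdd (lab (inj₂ (cyclic m)))

  outerParity-periodic : Periodic n outerParity
  outerParity-periodic m = cong (isOdd ∘ lab ∘ inj₁) (cyclic-periodic m)

  innerParity-periodic : Periodic n innerParity
  innerParity-periodic m = cong (isOdd ∘ lab ∘ inj₂) (cyclic-periodic m)

  private
    outer-at : ∀ i → outerParity (toℕ i) ≡ isOdd (lab (inj₁ i))
    outer-at i = cong (isOdd ∘ lab ∘ inj₁) (cyclic-toℕ i)

    inner-at : ∀ i → innerParity (toℕ i) ≡ isOdd (lab (inj₂ i))
    inner-at i = cong (isOdd ∘ lab ∘ inj₂) (cyclic-toℕ i)

  oddEdges-GP : oddEdges (GP n k) f ≡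
    cuts n outerParity 1 + (mismatches n outerParity innerParity 0 + (cuts n innerParity k + 0))
  oddEdges-GP = begin
    oddEdges (GP n k) f
      ≡⟨ length-filter-concatMap P? block n id H per-block ⟩
    ∑ n H
      ≡⟨ ∑-distrib-+ n (λ m → differ (X m) (X (m + 1))) rest₁ ⟩
    cuts n X 1 + ∑ n rest₁
      ≡⟨ cong (cuts n X 1 +_) (∑-distrib-+ n (λ m → differ (X m) (Y (m + 0))) rest₂) ⟩
    cuts n X 1 + (mismatches n X Y 0 + ∑ n rest₂)
      ≡⟨ cong (λ s → cuts n X 1 + (mismatches n X Y 0 + s))
              (∑-distrib-+ n (λ m → differ (Y m) (Y (m + k))) (λ _ → 0)) ⟩
    cuts n X 1 + (mismatches n X Y 0 + (cuts n Y k + ∑ n (λ _ → 0)))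
      ≡⟨ cong (λ s → cuts n X 1 + (mismatches n X Y 0 + (cuts n Y k + s)))
              (trans (∑-const n 0) (*-zeroʳ n)) ⟩
    cuts n X 1 + (mismatches n X Y 0 + (cuts n Y k + 0)) ∎
    where
    X = outerParity
    Y = innerParity
    P? = λ (e : (Fin n ⊎ Fin n) × (Fin n ⊎ Fin n)) → ¬? (lab (proj₁ e) % 2 ≟ lab (proj₂ e) % 2)
    block : Fin n → List ((Fin n ⊎ Fin n) × (Fin n ⊎ Fin n))
    block i = (inj₁ i , inj₁ (i +ₘ 1)) ∷ (inj₁ i , inj₂ i) ∷ (inj₂ i , inj₂ (i +ₘ k)) ∷ []
    H : ℕ → ℕ
    H m = differ (X m) (X (m + 1)) + (differ (X m) (Y (m + 0)) + (differ (Y m) (Y (m + k)) + 0))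
    rest₁ rest₂ : ℕ → ℕ
    rest₁ m = differ (X m) (Y (m + 0)) + (differ (Y m) (Y (m + k)) + 0)
    rest₂ m = differ (Y m) (Y (m + k)) + 0
    per-block : ∀ i → length (filter P? (block i)) ≡ H (toℕ i)
    per-block i = begin
      length (filter P? (block i))
        ≡⟨ length-filter-∷ P? e₁ (e₂ ∷ e₃ ∷ []) ⟩
      _ + length (filter P? (e₂ ∷ e₃ ∷ []))
        ≡⟨ cong₂ _+_ (parities-differ (lab u) (lab (inj₁ (i +ₘ 1))))
                     (trans (length-filter-∷ P? e₂ (e₃ ∷ []))
                            (cong₂ _+_ (parities-differ (lab u) (lab v))
                                       (trans (length-filter-∷ P? e₃ [])
                                              (cong (_+ 0) (parities-differ (lab v) (lab (inj₂ (i +ₘ k)))))))) ⟩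
      differ (isOdd (lab u)) (X (toℕ i + 1))
        + (differ (isOdd (lab u)) (isOdd (lab v)) + (differ (isOdd (lab v)) (Y (toℕ i + k)) + 0))
        ≡⟨ cong₂ _+_ (cong (λ b → differ b (X (toℕ i + 1))) (outer-at i))
                     (cong₂ _+_ (cong₂ differ (outer-at i) inner-at+0)
                                (cong (λ b → differ b (Y (toℕ i + k)) + 0) (inner-at i))) ⟨
      H (toℕ i) ∎
      where
      u = inj₁ i
      v = inj₂ i
      e₁ = (u , inj₁ (i +ₘ 1))
      e₂ = (u , v)
      e₃ = (v , inj₂ (i +ₘ k))
      inner-at+0 : Y (toℕ i + 0) ≡ isOdd (lab (inj₂ i))
      inner-at+0 = trans (cong Y (+-identityʳ (toℕ i))) (inner-at i)

  ones-outer+inner : ones n outerParity + ones n innerParity ≡ n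
  ones-outer+inner = begin
    ones n outerParity + ones n innerParity
      ≡⟨ cong₂ _+_ (sum-cong-≗ (cong bit ∘ outer-at)) (sum-cong-≗ (cong bit ∘ inner-at)) ⟩
    sum (odd-vertex ∘ inj₁) + sum (odd-vertex ∘ inj₂)
      ≡⟨ sum-splitAt n n odd-vertex ⟨
    sum (odd-vertex ∘ splitAt n)
      ≡⟨ sum-permute odd-label (↔-trans +↔⊎ f) ⟨
    ∑ (n + n) (λ m → bit (isOdd (suc m)))
      ≡⟨ ones-isOdd-suc n ⟩
    n ∎
    where
    odd-vertex : Fin n ⊎ Fin n → ℕ
    odd-vertex v = bit (isOdd (lab v))
    odd-label : Fin (n + n) → ℕ
    odd-label j = bit (isOdd (suc (toℕ j)))

lemma4p10 : (l : ℕ) → 3 ≤ l → ¬ RnaNumber (GP (suc (2 * l)) 2) 5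
lemma4p10 l 3≤l ((f , oddEdges≡5) , _) =
  changes≢5 l 3≤l (outerParity-periodic {k = 2} f) (innerParity-periodic {k = 2} f)
    (ones-outer+inner {k = 2} f) (trans (sym (oddEdges-GP f)) oddEdges≡5)
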